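{- (Cut elimination and subformula property.) The display calculi D.BL and D.CBL enjoy cut elimination: every sequent derivable in D.BL (resp. D.CBL) is derivable without using the Cut rule. Moreover, they enjoy the subformula property: every formula occurring in a cut-free derivation is a subformula of some formula occurring in its end-sequent.
   Context: The calculus D.BL has two types $i\in\{1,2\}$ with atoms $p_1,q_1,\dots$ (type 1) and $p_2,q_2,\dots$ (type 2). Type-1 formulas: $A_1::=p_1\mid 1_1\mid 0_1\mid \mathrm{p}A_2\mid A_1\sqcap_1A_1\mid A_1\sqcup_1A_1$; type-2: $A_2::=p_2\mid1_2\mid0_2\mid\mathrm{n}A_1\mid A_2\sqcap_2A_2\mid A_2\sqcup_2A_2$ (so, e.g., $A_2$ is a subformula of $\mathrm{p}A_2$). Type-$i$ structures: $X_i::=A_i\mid\hat1_i\mid\check0_i\mid X_i\hat\sqcap_iX_i\mid X_i\check\sqcup_iX_i\mid X_i\check\sqsupset_iX_i\mid X_i\hat\sqsubset_iX_i$, plus $\mathrm{P}X_2$ (type 1) and $\mathrm{N}X_1$ (type 2). Sequents $X_i\vdash Y_i$ have both sides of the same type. D.CBL adds formulas ${\sim}_iA_i$ and structures $\ast_iX_i$. Rules ($i\in\{1,2\}$; "$\Leftrightarrow$" = both directions): Display: $X_i\hat\sqcap_iY_i\vdash Z_i\Leftrightarrow X_i\vdash Y_i\check\sqsupset_iZ_i$; $X_i\vdash Y_i\check\sqcup_iZ_i\Leftrightarrow X_i\hat\sqsubset_iY_i\vdash Z_i$; $\mathrm{P}X_2\vdash Y_1\Leftrightarrow X_2\vdash\mathrm{N}Y_1$;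 $\mathrm{N}X_1\vdash Y_2\Leftrightarrow X_1\vdash\mathrm{P}Y_2$. Identity/cut: axiom $p_i\vdash p_i$; Cut: from $X_i\vdash A_i$ and $A_i\vdash Y_i$ infer $X_i\vdash Y_i$. Structural: from $X_i\hat\sqcap_i\hat1_i\vdash Y_i$ infer $X_i\vdash Y_i$; from $X_i\vdash Y_i\check\sqcup_i\check0_i$ infer $X_i\vdash Y_i$; exchange, associativity, weakening ($X\vdash Z$ / $X\hat\sqcap Y\vdash Z$ and $X\vdash Y$ / $X\vdash Y\check\sqcup Z$) and contraction ($X\hat\sqcap X\vdash Z$ / $X\vdash Z$ and $X\vdash Y\check\sqcup Y$ / $X\vdash Y$) for $\hat\sqcap_i$ on the left and $\check\sqcup_i$ on the right. Operational: from $\hat1_i\vdash X_i$ infer $1_i\vdash X_i$; axiom $\hat1_i\vdash1_i$; axiom $0_i\vdash\check0_i$; from $X_i\vdash\check0_i$ infer $X_i\vdash0_i$; from $A_i\hat\sqcap_iB_i\vdash X_i$ infer $A_i\sqcap_iB_i\vdash X_i$; from $X_i\vdash A_i$, $Y_i\vdash B_i$ infer $X_i\hat\sqcap_iY_i\vdash A_i\sqcap_iB_i$; from $A_i\vdash X_i$, $B_i\vdash Y_i$ infer $A_i\sqcup_iB_i\vdash X_i\check\sqcup_iY_i$; from $X_i\vdash A_i\check\sqcup_iB_i$ infer $X_i\vdash A_i\sqcup_iB_i$. Multi-type structural: $X_1\vdash Y_1\Leftrightarrow\mathrm{N}X_1\vdash\mathrm{N}Y_1$; $X_2\vdash Y_2\Leftrightarrow\mathrm{P}X_2\vdash\mathrm{P}Y_2$;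 from $\check0_1\vdash X_1$ infer $\mathrm{P}\check0_2\vdash X_1$; from $X_1\vdash\hat1_1$ infer $X_1\vdash\mathrm{P}\hat1_2$. Multi-type operational: from $\mathrm{N}A_1\vdash X_2$ infer $\mathrm{n}A_1\vdash X_2$; from $X_2\vdash\mathrm{N}A_1$ infer $X_2\vdash\mathrm{n}A_1$; from $\mathrm{P}A_2\vdash X_1$ infer $\mathrm{p}A_2\vdash X_1$; from $X_1\vdash\mathrm{P}A_2$ infer $X_1\vdash\mathrm{p}A_2$. D.CBL additionally: $\ast_iX_i\vdash Y_i\Leftrightarrow\ast_iY_i\vdash X_i$; $X_i\vdash\ast_iY_i\Leftrightarrow Y_i\vdash\ast_iX_i$; $X_i\vdash Y_i\Leftrightarrow\ast_iY_i\vdash\ast_iX_i$; from $\mathrm{N}\ast_1X_1\vdash Y_2$ infer $\ast_2\mathrm{N}X_1\vdash Y_2$; from $X_2\vdash\mathrm{N}\ast_1Y_1$ infer $X_2\vdash\ast_2\mathrm{N}Y_1$; from $\ast_iA_i\vdash Y_i$ infer ${\sim}_iA_i\vdash Y_i$; from $X_i\vdash\ast_iA_i$ infer $X_i\vdash{\sim}_iA_i$. -}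

module Defs where

open import Data.Nat using (ℕ)
open import Data.Bool using (Bool; true; false)
open import Data.Product using (Σ; _,_; _×_; ∃)
open import Relation.Binary.PropositionalEquality using (_≡_)
open import Relation.Binary.Construct.Closure.ReflexiveTransitive using (Star)

data Ty : Set where
  one two : Ty

data Calc : Set where
  BL CBL : Calc

data Fm : Calc → Ty → Set where
  atom : ∀ {c i} → ℕ → Fm c i
  𝟙    : ∀ {c i} → Fm c i
  𝟘    : ∀ {c i} → Fm c i
  _⊓_  : ∀ {c i} → Fm c i → Fm c i → Fm c i
  _⊔_  : ∀ {c i} → Fm c i → Fm c i → Fm c i
  p    : ∀ {c} → Fm c two → Fm c one
  n    : ∀ {c} → Fm c one → Fm c two
  ∼    : ∀ {i} → Fm CBL i → Fm CBL i   -- only in D.CBL (forced by the index)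

data Str : Calc → Ty → Set where
  fm   : ∀ {c i} → Fm c i → Str c i
  Î    : ∀ {c i} → Str c i
  Ǒ    : ∀ {c i} → Str c i
  _⊓̂_  : ∀ {c i} → Str c i → Str c i → Str c i
  _⊔̌_  : ∀ {c i} → Str c i → Str c i → Str c i
  _⊐̌_  : ∀ {c i} → Str c i → Str c i → Str c i
  _⊏̂_  : ∀ {c i} → Str c i → Str c i → Str c i
  P    : ∀ {c} → Str c two → Str c one
  N    : ∀ {c} → Str c one → Str c two
  ∗    : ∀ {i} → Str CBL i → Str CBL i

infixl 7 _⊓̂_
infixl 6 _⊔̌_
infixr 5 _⊐̌_
infixl 5 _⊏̂_
infix 3 _⊢_

data Seq (c : Calc) : Set where
  _⊢_ : ∀ {i} → Str c i → Str c i → Seq c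

data R0 : (c : Calc) → Seq c → Set where
  id   : ∀ {c i} (k : ℕ) → R0 c (fm {i = i} (atom k) ⊢ fm (atom k))
  1R   : ∀ {c i} → R0 c (Î {i = i} ⊢ fm 𝟙)
  0L   : ∀ {c i} → R0 c (fm {i = i} 𝟘 ⊢ Ǒ)

-- One-premise rules:  R1 c premise conclusion.
data R1 : (c : Calc) → Seq c → Seq c → Set where
  resL  : ∀ {c i} {X Y Z : Str c i} → R1 c (X ⊓̂ Y ⊢ Z) (X ⊢ Y ⊐̌ Z)
  resL' : ∀ {c i} {X Y Z : Str c i} → R1 c (X ⊢ Y ⊐̌ Z) (X ⊓̂ Y ⊢ Z)
  resR  : ∀ {c i} {X Y Z : Str c i} → R1 c (X ⊢ Y ⊔̌ Z) (X ⊏̂ Y ⊢ Z)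
  resR' : ∀ {c i} {X Y Z : Str c i} → R1 c (X ⊏̂ Y ⊢ Z) (X ⊢ Y ⊔̌ Z)
  PN    : ∀ {c} {X : Str c two} {Y : Str c one} → R1 c (P X ⊢ Y) (X ⊢ N Y)
  PN'   : ∀ {c} {X : Str c two} {Y : Str c one} → R1 c (X ⊢ N Y) (P X ⊢ Y)
  NP    : ∀ {c} {X : Str c one} {Y : Str c two} → R1 c (N X ⊢ Y) (X ⊢ P Y)
  NP'   : ∀ {c} {X : Str c one} {Y : Str c two} → R1 c (X ⊢ P Y) (N X ⊢ Y)
  Î-L   : ∀ {c i} {X Y : Str c i} → R1 c (X ⊓̂ Î ⊢ Y) (X ⊢ Y)
  Ǒ-R   : ∀ {c i} {X Y : Str c i} → R1 c (X ⊢ Y ⊔̌ Ǒ) (X ⊢ Y)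
  exL   : ∀ {c i} {X Y Z : Str c i} → R1 c (X ⊓̂ Y ⊢ Z) (Y ⊓̂ X ⊢ Z)
  exR   : ∀ {c i} {X Y Z : Str c i} → R1 c (X ⊢ Y ⊔̌ Z) (X ⊢ Z ⊔̌ Y)
  asL   : ∀ {c i} {X Y Z W : Str c i} → R1 c ((X ⊓̂ Y) ⊓̂ Z ⊢ W) (X ⊓̂ (Y ⊓̂ Z) ⊢ W)
  asL'  : ∀ {c i} {X Y Z W : Str c i} → R1 c (X ⊓̂ (Y ⊓̂ Z) ⊢ W) ((X ⊓̂ Y) ⊓̂ Z ⊢ W)
  asR   : ∀ {c i} {W X Y Z : Str c i} → R1 c (W ⊢ (X ⊔̌ Y) ⊔̌ Z) (W ⊢ X ⊔̌ (Y ⊔̌ Z))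
  asR'  : ∀ {c i} {W X Y Z : Str c i} → R1 c (W ⊢ X ⊔̌ (Y ⊔̌ Z)) (W ⊢ (X ⊔̌ Y) ⊔̌ Z)
  wL    : ∀ {c i} {X Y Z : Str c i} → R1 c (X ⊢ Z) (X ⊓̂ Y ⊢ Z)
  wR    : ∀ {c i} {X Y Z : Str c i} → R1 c (X ⊢ Y) (X ⊢ Y ⊔̌ Z)
  cL    : ∀ {c i} {X Z : Str c i} → R1 c (X ⊓̂ X ⊢ Z) (X ⊢ Z)
  cR    : ∀ {c i} {X Y : Str c i} → R1 c (X ⊢ Y ⊔̌ Y) (X ⊢ Y)
  1L    : ∀ {c i} {X : Str c i} → R1 c (Î ⊢ X) (fm 𝟙 ⊢ X)
  0R    : ∀ {c i} {X : Str c i} → R1 c (X ⊢ Ǒ) (X ⊢ fm 𝟘)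
  ⊓L    : ∀ {c i} {A B : Fm c i} {X : Str c i} → R1 c (fm A ⊓̂ fm B ⊢ X) (fm (A ⊓ B) ⊢ X)
  ⊔R    : ∀ {c i} {A B : Fm c i} {X : Str c i} → R1 c (X ⊢ fm A ⊔̌ fm B) (X ⊢ fm (A ⊔ B))
  N-mon  : ∀ {c} {X Y : Str c one} → R1 c (X ⊢ Y) (N X ⊢ N Y)
  N-mon' : ∀ {c} {X Y : Str c one} → R1 c (N X ⊢ N Y) (X ⊢ Y)
  P-mon  : ∀ {c} {X Y : Str c two} → R1 c (X ⊢ Y) (P X ⊢ P Y)
  P-mon' : ∀ {c} {X Y : Str c two} → R1 c (P X ⊢ P Y) (X ⊢ Y)
  PǑ     : ∀ {c} {X : Str c one} → R1 c (Ǒ ⊢ X) (P Ǒ ⊢ X)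
  PÎ     : ∀ {c} {X : Str c one} → R1 c (X ⊢ Î) (X ⊢ P Î)
  nL    : ∀ {c} {A : Fm c one} {X : Str c two} → R1 c (N (fm A) ⊢ X) (fm (n A) ⊢ X)
  nR    : ∀ {c} {A : Fm c one} {X : Str c two} → R1 c (X ⊢ N (fm A)) (X ⊢ fm (n A))
  pL    : ∀ {c} {A : Fm c two} {X : Str c one} → R1 c (P (fm A) ⊢ X) (fm (p A) ⊢ X)
  pR    : ∀ {c} {A : Fm c two} {X : Str c one} → R1 c (X ⊢ P (fm A)) (X ⊢ fm (p A))
  ∗L    : ∀ {i} {X Y : Str CBL i} → R1 CBL (∗ X ⊢ Y) (∗ Y ⊢ X)
  ∗R    : ∀ {i} {X Y : Str CBL i} → R1 CBL (X ⊢ ∗ Y) (Y ⊢ ∗ X)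
  ∗C    : ∀ {i} {X Y : Str CBL i} → R1 CBL (X ⊢ Y) (∗ Y ⊢ ∗ X)
  ∗C'   : ∀ {i} {X Y : Str CBL i} → R1 CBL (∗ Y ⊢ ∗ X) (X ⊢ Y)
  N∗L   : ∀ {X : Str CBL one} {Y : Str CBL two} → R1 CBL (N (∗ X) ⊢ Y) (∗ (N X) ⊢ Y)
  N∗R   : ∀ {X : Str CBL two} {Y : Str CBL one} → R1 CBL (X ⊢ N (∗ Y)) (X ⊢ ∗ (N Y))
  ∼L    : ∀ {i} {A : Fm CBL i} {Y : Str CBL i} → R1 CBL (∗ (fm A) ⊢ Y) (fm (∼ A) ⊢ Y)
  ∼R    : ∀ {i} {A : Fm CBL i} {X : Str CBL i} → R1 CBL (X ⊢ ∗ (fm A)) (X ⊢ fm (∼ A))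

-- Two-premise rules (other than Cut):  R2 c premise₁ premise₂ conclusion.
data R2 : (c : Calc) → Seq c → Seq c → Seq c → Set where
  ⊓R : ∀ {c i} {A B : Fm c i} {X Y : Str c i} →
       R2 c (X ⊢ fm A) (Y ⊢ fm B) (X ⊓̂ Y ⊢ fm (A ⊓ B))
  ⊔L : ∀ {c i} {A B : Fm c i} {X Y : Str c i} →
       R2 c (fm A ⊢ X) (fm B ⊢ Y) (fm (A ⊔ B) ⊢ X ⊔̌ Y)

-- Derivations in calculus c; Cut may be used only when cutOK ≡ true.
data Der (c : Calc) (cutOK : Bool) : Seq c → Set where
  rule0 : ∀ {s} → R0 c s → Der c cutOK s
  rule1 : ∀ {s t} → R1 c s t → Der c cutOK s → Der c cutOK t
  rule2 : ∀ {s t u} → R2 c s t u → Der c cutOK s → Der c cutOK t → Der c cutOK u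
  cut   : ∀ {i} {X Y : Str c i} {A : Fm c i} → cutOK ≡ true →
          Der c cutOK (X ⊢ fm A) → Der c cutOK (fm A ⊢ Y) → Der c cutOK (X ⊢ Y)

TFm : Calc → Set
TFm c = Σ Ty (Fm c)

data Imm : (c : Calc) → TFm c → TFm c → Set where
  ⊓l : ∀ {c i} {A B : Fm c i} → Imm c (i , A) (i , A ⊓ B)
  ⊓r : ∀ {c i} {A B : Fm c i} → Imm c (i , B) (i , A ⊓ B)
  ⊔l : ∀ {c i} {A B : Fm c i} → Imm c (i , A) (i , A ⊔ B)
  ⊔r : ∀ {c i} {A B : Fm c i} → Imm c (i , B) (i , A ⊔ B)
  p◁ : ∀ {c} {A : Fm c two} → Imm c (two , A) (one , p A)
  n◁ : ∀ {c} {A : Fm c one} → Imm c (one , A) (two , n A)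
  ∼◁ : ∀ {i} {A : Fm CBL i} → Imm CBL (i , A) (i , ∼ A)

_⊑_ : {c : Calc} → TFm c → TFm c → Set
_⊑_ {c} = Star (Imm c)

data _∈S_ : {c : Calc} → TFm c → ∀ {i} → Str c i → Set where
  here : ∀ {c i} {A : Fm c i} → (i , A) ∈S fm A
  ⊓̂l   : ∀ {c F i} {X Y : Str c i} → F ∈S X → F ∈S (X ⊓̂ Y)
  ⊓̂r   : ∀ {c F i} {X Y : Str c i} → F ∈S Y → F ∈S (X ⊓̂ Y)
  ⊔̌l   : ∀ {c F i} {X Y : Str c i} → F ∈S X → F ∈S (X ⊔̌ Y)
  ⊔̌r   : ∀ {c F i} {X Y : Str c i} → F ∈S Y → F ∈S (X ⊔̌ Y)
  ⊐̌l   : ∀ {c F i} {X Y : Str c i} → F ∈S X → F ∈S (X ⊐̌ Y)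
  ⊐̌r   : ∀ {c F i} {X Y : Str c i} → F ∈S Y → F ∈S (X ⊐̌ Y)
  ⊏̂l   : ∀ {c F i} {X Y : Str c i} → F ∈S X → F ∈S (X ⊏̂ Y)
  ⊏̂r   : ∀ {c F i} {X Y : Str c i} → F ∈S Y → F ∈S (X ⊏̂ Y)
  inP  : ∀ {c F} {X : Str c two} → F ∈S X → F ∈S P X
  inN  : ∀ {c F} {X : Str c one} → F ∈S X → F ∈S N X
  in∗  : ∀ {F i} {X : Str CBL i} → F ∈S X → F ∈S ∗ X

data _∈Seq_ {c : Calc} (F : TFm c) : Seq c → Set where
  inLhs : ∀ {i} {X Y : Str c i} → F ∈S X → F ∈Seq (X ⊢ Y)
  inRhs : ∀ {i} {X Y : Str c i} → F ∈S Y → F ∈Seq (X ⊢ Y)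

data _∈Der_ {c : Calc} {b : Bool} (F : TFm c) : ∀ {s} → Der c b s → Set where
  atRoot : ∀ {s} {d : Der c b s} → F ∈Seq s → F ∈Der d
  above1 : ∀ {s t} {r : R1 c s t} {d : Der c b s} → F ∈Der d → F ∈Der rule1 r d
  above2l : ∀ {s t u} {r : R2 c s t u} {d : Der c b s} {e : Der c b t} →
            F ∈Der d → F ∈Der rule2 r d e
  above2r : ∀ {s t u} {r : R2 c s t u} {d : Der c b s} {e : Der c b t} →
            F ∈Der e → F ∈Der rule2 r d e
  aboveCl : ∀ {i} {X Y : Str c i} {A : Fm c i} {q : b ≡ true}
              {d : Der c b (X ⊢ fm A)} {e : Der c b (fm A ⊢ Y)} →
            F ∈Der d → F ∈Der cut q d e
  aboveCr : ∀ {i} {X Y : Str c i} {A : Fm c i} {q : b ≡ true}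
              {d : Der c b (X ⊢ fm A)} {e : Der c b (fm A ⊢ Y)} →
            F ∈Der e → F ∈Der cut q d e

CutElimination : Calc → Set
CutElimination c = ∀ (s : Seq c) → Der c true s → Der c false s

SubformulaProperty : Calc → Set
SubformulaProperty c = ∀ (s : Seq c) (d : Der c false s) (F : TFm c) →
  F ∈Der d → ∃ λ G → G ∈Seq s × F ⊑ G

-- Cut is admissible, by induction on the cut formula C.  Given cut-free derivations of X ⊢ C and
-- C ⊢ Y, follow the succedent occurrences of C upwards through the first derivation and replace
-- them by Y; every rule except the one introducing C stays an instance of the same rule.  Where C
-- is introduced on the right, say as Z ⊢ C, follow the antecedent occurrences of C upwards through
-- the derivation of C ⊢ Y and replace them by Z.  Where C is introduced there on the left, both
-- introductions are principal, and the display rules bring the immediate subformulas of C into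
-- position for cuts that are admissible by the induction hypothesis.  The subformula property
-- holds because every rule other than Cut is analytic.
module Submission where

open import Defs
open import Data.Product using (_×_; _,_; ∃; proj₂)
open import Data.Bool using (false)
open import Relation.Binary.Construct.Closure.ReflexiveTransitive using (ε; _◅_; _◅◅_)

CutFree : (c : Calc) → Seq c → Set
CutFree c = Der c false

data Part : Set where
  antecedent succedent : Part

opposite : Part → Part
opposite antecedent = succedent
opposite succedent  = antecedent

variable
  c : Calc
  i j : Ty
  π tp : Part
  C : Fm c j
  X : Str c j
  s t : Seq c

infixl 7 _⊓̂_
infixl 6 _⊔̌_
infixr 5 _⊐̌_
infixl 5 _⊏̂_
infix 3 _⊢_

-- Replace tp C X π S S′: S′ arises from S by replacing some occurrences of fm C by X, where S sits
-- in a π-part of its sequent and only occurrences in tp-parts may be replaced.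
data Replace (tp : Part) : (C : Fm c j) → Str c j → Part → Str c i → Str c i → Set where
  keep    : {F : Fm c i} → Replace tp C X π (fm F) (fm F)
  replace : Replace tp C X tp (fm C) X
  Î       : Replace tp C X π (Î {i = i}) Î
  Ǒ       : Replace tp C X π (Ǒ {i = i}) Ǒ
  _⊓̂_     : {S S′ T T′ : Str c i} →
            Replace tp C X π S S′ → Replace tp C X π T T′ → Replace tp C X π (S ⊓̂ T) (S′ ⊓̂ T′)
  _⊔̌_     : {S S′ T T′ : Str c i} →
            Replace tp C X π S S′ → Replace tp C X π T T′ → Replace tp C X π (S ⊔̌ T) (S′ ⊔̌ T′)
  _⊐̌_     : {S S′ T T′ : Str c i} →
            Replace tp C X (opposite π) S S′ → Replace tp C X π T T′ →
            Replace tp C X π (S ⊐̌ T) (S′ ⊐̌ T′)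
  _⊏̂_     : {S S′ T T′ : Str c i} →
            Replace tp C X π S S′ → Replace tp C X (opposite π) T T′ →
            Replace tp C X π (S ⊏̂ T) (S′ ⊏̂ T′)
  P       : {S S′ : Str c two} → Replace tp C X π S S′ → Replace tp C X π (P S) (P S′)
  N       : {S S′ : Str c one} → Replace tp C X π S S′ → Replace tp C X π (N S) (N S′)
  ∗       : {C : Fm CBL j} {X : Str CBL j} {S S′ : Str CBL i} →
            Replace tp C X (opposite π) S S′ → Replace tp C X π (∗ S) (∗ S′)

Replace-refl : ∀ π (S : Str c i) → Replace tp C X π S S
Replace-refl π (fm F)  = keep
Replace-refl π Î       = Î
Replace-refl π Ǒ       = Ǒ
Replace-refl π (S ⊓̂ T) = Replace-refl π S ⊓̂ Replace-refl π T
Replace-refl π (S ⊔̌ T) = Replace-refl π S ⊔̌ Replace-refl π T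
Replace-refl π (S ⊐̌ T) = Replace-refl (opposite π) S ⊐̌ Replace-refl π T
Replace-refl π (S ⊏̂ T) = Replace-refl π S ⊏̂ Replace-refl (opposite π) T
Replace-refl π (P S)   = P (Replace-refl π S)
Replace-refl π (N S)   = N (Replace-refl π S)
Replace-refl π (∗ S)   = ∗ (Replace-refl (opposite π) S)

data ReplaceSeq (tp : Part) (C : Fm c j) (X : Str c j) : Seq c → Seq c → Set where
  _⊢_ : {L L′ R R′ : Str c i} → Replace tp C X antecedent L L′ → Replace tp C X succedent R R′ →
        ReplaceSeq tp C X (L ⊢ R) (L′ ⊢ R′)

-- Instances of the rules introducing C in a tp-part, with the introduced occurrence replaced by X.
data PrincipalAxiom : Part → (C : Fm c j) → Str c j → Seq c → Set where
  idˡ : ∀ {k} → PrincipalAxiom antecedent (atom k) X (X ⊢ fm (atom k))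
  idʳ : ∀ {k} → PrincipalAxiom succedent (atom k) X (fm (atom k) ⊢ X)
  1R  : PrincipalAxiom succedent 𝟙 X (Î ⊢ X)
  0L  : PrincipalAxiom antecedent 𝟘 X (X ⊢ Ǒ)

data PrincipalRule₁ : Part → (C : Fm c j) → Str c j → Seq c → Seq c → Set where
  1L : {Z : Str c j} → PrincipalRule₁ antecedent 𝟙 X (Î ⊢ Z) (X ⊢ Z)
  ⊓L : {A B : Fm c j} {Z : Str c j} → PrincipalRule₁ antecedent (A ⊓ B) X (fm A ⊓̂ fm B ⊢ Z) (X ⊢ Z)
  nL : {A : Fm c one} {X Z : Str c two} → PrincipalRule₁ antecedent (n A) X (N (fm A) ⊢ Z) (X ⊢ Z)
  pL : {A : Fm c two} {X Z : Str c one} → PrincipalRule₁ antecedent (p A) X (P (fm A) ⊢ Z) (X ⊢ Z)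
  ∼L : {A : Fm CBL j} {X Z : Str CBL j} → PrincipalRule₁ antecedent (∼ A) X (∗ (fm A) ⊢ Z) (X ⊢ Z)
  0R : {Z : Str c j} → PrincipalRule₁ succedent 𝟘 X (Z ⊢ Ǒ) (Z ⊢ X)
  ⊔R : {A B : Fm c j} {Z : Str c j} → PrincipalRule₁ succedent (A ⊔ B) X (Z ⊢ fm A ⊔̌ fm B) (Z ⊢ X)
  nR : {A : Fm c one} {X Z : Str c two} → PrincipalRule₁ succedent (n A) X (Z ⊢ N (fm A)) (Z ⊢ X)
  pR : {A : Fm c two} {X Z : Str c one} → PrincipalRule₁ succedent (p A) X (Z ⊢ P (fm A)) (Z ⊢ X)
  ∼R : {A : Fm CBL j} {X Z : Str CBL j} → PrincipalRule₁ succedent (∼ A) X (Z ⊢ ∗ (fm A)) (Z ⊢ X)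

data PrincipalRule₂ : Part → (C : Fm c j) → Str c j → Seq c → Seq c → Seq c → Set where
  ⊓R : {A B : Fm c j} {Y Z : Str c j} →
       PrincipalRule₂ succedent (A ⊓ B) X (Y ⊢ fm A) (Z ⊢ fm B) (Y ⊓̂ Z ⊢ X)
  ⊔L : {A B : Fm c j} {Y Z : Str c j} →
       PrincipalRule₂ antecedent (A ⊔ B) X (fm A ⊢ Y) (fm B ⊢ Z) (X ⊢ Y ⊔̌ Z)

-- The rule ending a derivation of t, carried along a replacement of t by t′: either it stays an
-- instance of the same rule, or the replaced occurrence was its principal formula.
data Lift₀ (tp : Part) (C : Fm c j) (X : Str c j) (t′ : Seq c) : Set where
  parametric : R0 c t′ → Lift₀ tp C X t′
  principal  : PrincipalAxiom tp C X t′ → Lift₀ tp C X t′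

data Lift₁ (tp : Part) (C : Fm c j) (X : Str c j) (s t′ : Seq c) : Set where
  parametric : ∀ {s′} → ReplaceSeq tp C X s s′ → R1 c s′ t′ → Lift₁ tp C X s t′
  principal  : ∀ {s′} → ReplaceSeq tp C X s s′ → PrincipalRule₁ tp C X s′ t′ → Lift₁ tp C X s t′

data Lift₂ (tp : Part) (C : Fm c j) (X : Str c j) (s₁ s₂ t′ : Seq c) : Set where
  parametric : ∀ {s₁′ s₂′} → ReplaceSeq tp C X s₁ s₁′ → ReplaceSeq tp C X s₂ s₂′ →
               R2 c s₁′ s₂′ t′ → Lift₂ tp C X s₁ s₂ t′
  principal  : ∀ {s₁′ s₂′} → ReplaceSeq tp C X s₁ s₁′ → ReplaceSeq tp C X s₂ s₂′ →
               PrincipalRule₂ tp C X s₁′ s₂′ t′ → Lift₂ tp C X s₁ s₂ t′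

lift₀ : ∀ {t′} → R0 c t → ReplaceSeq tp C X t t′ → Lift₀ tp C X t′
lift₀ (id k) (keep    ⊢ keep)    = parametric (id k)
lift₀ (id k) (replace ⊢ keep)    = principal idˡ
lift₀ (id k) (keep    ⊢ replace) = principal idʳ
lift₀ 1R     (Î       ⊢ keep)    = parametric 1R
lift₀ 1R     (Î       ⊢ replace) = principal 1R
lift₀ 0L     (keep    ⊢ Ǒ)       = parametric 0L
lift₀ 0L     (replace ⊢ Ǒ)       = principal 0L

lift₁ : ∀ {t′} → R1 c s t → ReplaceSeq tp C X t t′ → Lift₁ tp C X s t′
lift₁ resL   (x ⊢ y ⊐̌ z)           = parametric (x ⊓̂ y ⊢ z) resL
lift₁ resL'  (x ⊓̂ y ⊢ z)           = parametric (x ⊢ y ⊐̌ z) resL'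
lift₁ resR   (x ⊏̂ y ⊢ z)           = parametric (x ⊢ y ⊔̌ z) resR
lift₁ resR'  (x ⊢ y ⊔̌ z)           = parametric (x ⊏̂ y ⊢ z) resR'
lift₁ PN     (x ⊢ N y)             = parametric (P x ⊢ y) PN
lift₁ PN'    (P x ⊢ y)             = parametric (x ⊢ N y) PN'
lift₁ NP     (x ⊢ P y)             = parametric (N x ⊢ y) NP
lift₁ NP'    (N x ⊢ y)             = parametric (x ⊢ P y) NP'
lift₁ Î-L    (x ⊢ y)               = parametric (x ⊓̂ Î ⊢ y) Î-L
lift₁ Ǒ-R    (x ⊢ y)               = parametric (x ⊢ y ⊔̌ Ǒ) Ǒ-R
lift₁ exL    (y ⊓̂ x ⊢ z)           = parametric (x ⊓̂ y ⊢ z) exL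
lift₁ exR    (x ⊢ z ⊔̌ y)           = parametric (x ⊢ y ⊔̌ z) exR
lift₁ asL    (x ⊓̂ (y ⊓̂ z) ⊢ w)     = parametric (x ⊓̂ y ⊓̂ z ⊢ w) asL
lift₁ asL'   (x ⊓̂ y ⊓̂ z ⊢ w)       = parametric (x ⊓̂ (y ⊓̂ z) ⊢ w) asL'
lift₁ asR    (w ⊢ x ⊔̌ (y ⊔̌ z))     = parametric (w ⊢ x ⊔̌ y ⊔̌ z) asR
lift₁ asR'   (w ⊢ x ⊔̌ y ⊔̌ z)       = parametric (w ⊢ x ⊔̌ (y ⊔̌ z)) asR'
lift₁ wL     (x ⊓̂ y ⊢ z)           = parametric (x ⊢ z) wL
lift₁ wR     (x ⊢ y ⊔̌ z)           = parametric (x ⊢ y) wR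
lift₁ cL     (x ⊢ z)               = parametric (x ⊓̂ x ⊢ z) cL
lift₁ cR     (x ⊢ y)               = parametric (x ⊢ y ⊔̌ y) cR
lift₁ 1L     (keep ⊢ x)            = parametric (Î ⊢ x) 1L
lift₁ 1L     (replace ⊢ x)         = principal (Î ⊢ x) 1L
lift₁ 0R     (x ⊢ keep)            = parametric (x ⊢ Ǒ) 0R
lift₁ 0R     (x ⊢ replace)         = principal (x ⊢ Ǒ) 0R
lift₁ ⊓L     (keep ⊢ x)            = parametric (keep ⊓̂ keep ⊢ x) ⊓L
lift₁ ⊓L     (replace ⊢ x)         = principal (keep ⊓̂ keep ⊢ x) ⊓L
lift₁ ⊔R     (x ⊢ keep)            = parametric (x ⊢ keep ⊔̌ keep) ⊔R
lift₁ ⊔R     (x ⊢ replace)         = principal (x ⊢ keep ⊔̌ keep) ⊔R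
lift₁ N-mon  (N x ⊢ N y)           = parametric (x ⊢ y) N-mon
lift₁ N-mon' (x ⊢ y)               = parametric (N x ⊢ N y) N-mon'
lift₁ P-mon  (P x ⊢ P y)           = parametric (x ⊢ y) P-mon
lift₁ P-mon' (x ⊢ y)               = parametric (P x ⊢ P y) P-mon'
lift₁ PǑ     (P Ǒ ⊢ x)             = parametric (Ǒ ⊢ x) PǑ
lift₁ PÎ     (x ⊢ P Î)             = parametric (x ⊢ Î) PÎ
lift₁ nL     (keep ⊢ x)            = parametric (N keep ⊢ x) nL
lift₁ nL     (replace ⊢ x)         = principal (N keep ⊢ x) nL
lift₁ nR     (x ⊢ keep)            = parametric (x ⊢ N keep) nR
lift₁ nR     (x ⊢ replace)         = principal (x ⊢ N keep) nR
lift₁ pL     (keep ⊢ x)            = parametric (P keep ⊢ x) pL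
lift₁ pL     (replace ⊢ x)         = principal (P keep ⊢ x) pL
lift₁ pR     (x ⊢ keep)            = parametric (x ⊢ P keep) pR
lift₁ pR     (x ⊢ replace)         = principal (x ⊢ P keep) pR
lift₁ ∗L     (∗ y ⊢ x)             = parametric (∗ x ⊢ y) ∗L
lift₁ ∗R     (y ⊢ ∗ x)             = parametric (x ⊢ ∗ y) ∗R
lift₁ ∗C     (∗ y ⊢ ∗ x)           = parametric (x ⊢ y) ∗C
lift₁ ∗C'    (x ⊢ y)               = parametric (∗ y ⊢ ∗ x) ∗C'
lift₁ N∗L    (∗ (N x) ⊢ y)         = parametric (N (∗ x) ⊢ y) N∗L
lift₁ N∗R    (x ⊢ ∗ (N y))         = parametric (x ⊢ N (∗ y)) N∗R
lift₁ ∼L     (keep ⊢ x)            = parametric (∗ keep ⊢ x) ∼L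
lift₁ ∼L     (replace ⊢ x)         = principal (∗ keep ⊢ x) ∼L
lift₁ ∼R     (x ⊢ keep)            = parametric (x ⊢ ∗ keep) ∼R
lift₁ ∼R     (x ⊢ replace)         = principal (x ⊢ ∗ keep) ∼R

lift₂ : ∀ {s₁ s₂ t′} → R2 c s₁ s₂ t → ReplaceSeq tp C X t t′ → Lift₂ tp C X s₁ s₂ t′
lift₂ ⊓R (x ⊓̂ y ⊢ keep)    = parametric (x ⊢ keep) (y ⊢ keep) ⊓R
lift₂ ⊓R (x ⊓̂ y ⊢ replace) = principal  (x ⊢ keep) (y ⊢ keep) ⊓R
lift₂ ⊔L (keep ⊢ x ⊔̌ y)    = parametric (keep ⊢ x) (keep ⊢ y) ⊔L
lift₂ ⊔L (replace ⊢ x ⊔̌ y) = principal  (keep ⊢ x) (keep ⊢ y) ⊔L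

CutAdmissible : Fm c i → Set
CutAdmissible {c} A = ∀ {X Y} → CutFree c (X ⊢ fm A) → CutFree c (fm A ⊢ Y) → CutFree c (X ⊢ Y)

CutAdmissibleBelow : Fm c i → Set
CutAdmissibleBelow {c} {i} C = ∀ {F} → Imm c F (i , C) → CutAdmissible (proj₂ F)

cut-⊓̂ˡ : {A : Fm c i} {X Y Z : Str c i} → CutAdmissible A →
         CutFree c (X ⊢ fm A) → CutFree c (fm A ⊓̂ Y ⊢ Z) → CutFree c (X ⊓̂ Y ⊢ Z)
cut-⊓̂ˡ cutA d e = rule1 resL' (cutA d (rule1 resL e))

cut-⊔̌ʳ : {B : Fm c i} {X Y Z : Str c i} → CutAdmissible B →
         CutFree c (X ⊢ Y ⊔̌ fm B) → CutFree c (fm B ⊢ Z) → CutFree c (X ⊢ Y ⊔̌ Z)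
cut-⊔̌ʳ cutB d e = rule1 resR' (cutB (rule1 resR d) e)

-- RightIntro C X: the premises, cut-free, of a right introduction of C with antecedent X.
data RightIntro : (C : Fm c j) → Str c j → Set where
  id-intro : ∀ {k} → RightIntro (atom {c} {j} k) (fm (atom k))
  𝟙-intro  : RightIntro (𝟙 {c} {j}) Î
  𝟘-intro  : CutFree c (X ⊢ Ǒ) → RightIntro 𝟘 X
  ⊓-intro  : {A B : Fm c j} {Y Z : Str c j} →
             CutFree c (Y ⊢ fm A) → CutFree c (Z ⊢ fm B) → RightIntro (A ⊓ B) (Y ⊓̂ Z)
  ⊔-intro  : {A B : Fm c j} → CutFree c (X ⊢ fm A ⊔̌ fm B) → RightIntro (A ⊔ B) X
  p-intro  : {A : Fm c two} {X : Str c one} → CutFree c (X ⊢ P (fm A)) → RightIntro (p A) X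
  n-intro  : {A : Fm c one} {X : Str c two} → CutFree c (X ⊢ N (fm A)) → RightIntro (n A) X
  ∼-intro  : {A : Fm CBL j} {X : Str CBL j} → CutFree CBL (X ⊢ ∗ (fm A)) → RightIntro (∼ A) X

reduce-principal-axiom : PrincipalAxiom antecedent C X t → RightIntro C X → CutFree c t
reduce-principal-axiom idˡ id-intro    = rule0 (id _)
reduce-principal-axiom 0L  (𝟘-intro d) = d

reduce-principal-rule₁ : PrincipalRule₁ antecedent C X s t → CutAdmissibleBelow C → RightIntro C X →
                         CutFree c s → CutFree c t
reduce-principal-rule₁ 1L _  𝟙-intro        e = e
reduce-principal-rule₁ ⊓L ih (⊓-intro d d′) e =
  rule1 exL (cut-⊓̂ˡ (ih ⊓r) d′ (rule1 exL (cut-⊓̂ˡ (ih ⊓l) d e)))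
reduce-principal-rule₁ nL ih (n-intro d)    e = rule1 P-mon' (ih n◁ (rule1 PN' d) (rule1 NP e))
reduce-principal-rule₁ pL ih (p-intro d)    e = rule1 N-mon' (ih p◁ (rule1 NP' d) (rule1 PN e))
reduce-principal-rule₁ ∼L ih (∼-intro d)    e = rule1 ∗C' (ih ∼◁ (rule1 ∗L e) (rule1 ∗R d))

reduce-principal-rule₂ : ∀ {s₁ s₂} → PrincipalRule₂ antecedent C X s₁ s₂ t → CutAdmissibleBelow C →
                         RightIntro C X → CutFree c s₁ → CutFree c s₂ → CutFree c t
reduce-principal-rule₂ ⊔L ih (⊔-intro d) e₁ e₂ =
  rule1 exR (cut-⊔̌ʳ (ih ⊔l) (rule1 exR (cut-⊔̌ʳ (ih ⊔r) d e₂)) e₁)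

module _ {C : Fm c j} {X : Str c j} (ih : CutAdmissibleBelow C) (r : RightIntro C X) where

  replace-antecedent-parts : CutFree c s → ReplaceSeq antecedent C X s t → CutFree c t
  replace-antecedent-parts (rule0 ρ) σ with lift₀ ρ σ
  ... | parametric ρ′ = rule0 ρ′
  ... | principal q   = reduce-principal-axiom q r
  replace-antecedent-parts (rule1 ρ d) σ with lift₁ ρ σ
  ... | parametric σ′ ρ′ = rule1 ρ′ (replace-antecedent-parts d σ′)
  ... | principal  σ′ q  = reduce-principal-rule₁ q ih r (replace-antecedent-parts d σ′)
  replace-antecedent-parts (rule2 ρ d₁ d₂) σ with lift₂ ρ σ
  ... | parametric σ₁ σ₂ ρ′ =
    rule2 ρ′ (replace-antecedent-parts d₁ σ₁) (replace-antecedent-parts d₂ σ₂)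
  ... | principal σ₁ σ₂ q =
    reduce-principal-rule₂ q ih r (replace-antecedent-parts d₁ σ₁) (replace-antecedent-parts d₂ σ₂)
  replace-antecedent-parts (cut () _ _) _

module _ {C : Fm c j} {Y : Str c j} (ih : CutAdmissibleBelow C) (e : CutFree c (fm C ⊢ Y)) where

  cut-right-intro : RightIntro C X → CutFree c (X ⊢ Y)
  cut-right-intro r = replace-antecedent-parts ih r e (replace ⊢ Replace-refl succedent Y)

  cut-principal-axiom : PrincipalAxiom succedent C Y t → CutFree c t
  cut-principal-axiom idʳ = cut-right-intro id-intro
  cut-principal-axiom 1R  = cut-right-intro 𝟙-intro

  cut-principal-rule₁ : PrincipalRule₁ succedent C Y s t → CutFree c s → CutFree c t
  cut-principal-rule₁ 0R d = cut-right-intro (𝟘-intro d)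
  cut-principal-rule₁ ⊔R d = cut-right-intro (⊔-intro d)
  cut-principal-rule₁ nR d = cut-right-intro (n-intro d)
  cut-principal-rule₁ pR d = cut-right-intro (p-intro d)
  cut-principal-rule₁ ∼R d = cut-right-intro (∼-intro d)

  cut-principal-rule₂ : ∀ {s₁ s₂} → PrincipalRule₂ succedent C Y s₁ s₂ t →
                        CutFree c s₁ → CutFree c s₂ → CutFree c t
  cut-principal-rule₂ ⊓R d₁ d₂ = cut-right-intro (⊓-intro d₁ d₂)

  replace-succedent-parts : CutFree c s → ReplaceSeq succedent C Y s t → CutFree c t
  replace-succedent-parts (rule0 ρ) σ with lift₀ ρ σ
  ... | parametric ρ′ = rule0 ρ′
  ... | principal q   = cut-principal-axiom q
  replace-succedent-parts (rule1 ρ d) σ with lift₁ ρ σ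
  ... | parametric σ′ ρ′ = rule1 ρ′ (replace-succedent-parts d σ′)
  ... | principal  σ′ q  = cut-principal-rule₁ q (replace-succedent-parts d σ′)
  replace-succedent-parts (rule2 ρ d₁ d₂) σ with lift₂ ρ σ
  ... | parametric σ₁ σ₂ ρ′ =
    rule2 ρ′ (replace-succedent-parts d₁ σ₁) (replace-succedent-parts d₂ σ₂)
  ... | principal σ₁ σ₂ q =
    cut-principal-rule₂ q (replace-succedent-parts d₁ σ₁) (replace-succedent-parts d₂ σ₂)
  replace-succedent-parts (cut () _ _) _

mutual
  cut-admissible : (C : Fm c i) → CutAdmissible C
  cut-admissible C {X} d e =
    replace-succedent-parts (cut-admissible-below C) e d (Replace-refl antecedent X ⊢ replace)

  cut-admissible-below : (C : Fm c i) → CutAdmissibleBelow C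
  cut-admissible-below (A ⊓ B) ⊓l = cut-admissible A
  cut-admissible-below (A ⊓ B) ⊓r = cut-admissible B
  cut-admissible-below (A ⊔ B) ⊔l = cut-admissible A
  cut-admissible-below (A ⊔ B) ⊔r = cut-admissible B
  cut-admissible-below (p A)   p◁ = cut-admissible A
  cut-admissible-below (n A)   n◁ = cut-admissible A
  cut-admissible-below (∼ A)   ∼◁ = cut-admissible A

eliminate-cuts : ∀ {b} → Der c b s → CutFree c s
eliminate-cuts (rule0 ρ)     = rule0 ρ
eliminate-cuts (rule1 ρ d)   = rule1 ρ (eliminate-cuts d)
eliminate-cuts (rule2 ρ d e) = rule2 ρ (eliminate-cuts d) (eliminate-cuts e)
eliminate-cuts (cut _ d e)   = cut-admissible _ (eliminate-cuts d) (eliminate-cuts e)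

infix 4 _≼_ _⊴_

_≼_ : TFm c → Seq c → Set
F ≼ s = ∃ λ G → G ∈Seq s × F ⊑ G

_⊴_ : Seq c → Seq c → Set
s ⊴ t = ∀ {F} → F ∈Seq s → F ≼ t

≼-trans : {F : TFm c} → F ≼ s → s ⊴ t → F ≼ t
≼-trans (G , G∈s , F⊑G) s⊴t with s⊴t G∈s
... | H , H∈t , G⊑H = H , H∈t , F⊑G ◅◅ G⊑H

private
  pattern L m = inLhs m
  pattern R m = inRhs m

  occurs : {F : TFm c} → F ∈Seq t → F ≼ t
  occurs m = _ , m , ε

  immediate : {F G : TFm c} → Imm c F G → G ∈Seq t → F ≼ t
  immediate step m = _ , m , step ◅ ε

R1-analytic : R1 c s t → s ⊴ t
R1-analytic resL   (L (⊓̂l m))       = occurs (L m)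
R1-analytic resL   (L (⊓̂r m))       = occurs (R (⊐̌l m))
R1-analytic resL   (R m)            = occurs (R (⊐̌r m))
R1-analytic resL'  (L m)            = occurs (L (⊓̂l m))
R1-analytic resL'  (R (⊐̌l m))       = occurs (L (⊓̂r m))
R1-analytic resL'  (R (⊐̌r m))       = occurs (R m)
R1-analytic resR   (L m)            = occurs (L (⊏̂l m))
R1-analytic resR   (R (⊔̌l m))       = occurs (L (⊏̂r m))
R1-analytic resR   (R (⊔̌r m))       = occurs (R m)
R1-analytic resR'  (L (⊏̂l m))       = occurs (L m)
R1-analytic resR'  (L (⊏̂r m))       = occurs (R (⊔̌l m))
R1-analytic resR'  (R m)            = occurs (R (⊔̌r m))
R1-analytic PN     (L (inP m))      = occurs (L m)
R1-analytic PN     (R m)            = occurs (R (inN m))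
R1-analytic PN'    (L m)            = occurs (L (inP m))
R1-analytic PN'    (R (inN m))      = occurs (R m)
R1-analytic NP     (L (inN m))      = occurs (L m)
R1-analytic NP     (R m)            = occurs (R (inP m))
R1-analytic NP'    (L m)            = occurs (L (inN m))
R1-analytic NP'    (R (inP m))      = occurs (R m)
R1-analytic Î-L    (L (⊓̂l m))       = occurs (L m)
R1-analytic Î-L    (R m)            = occurs (R m)
R1-analytic Ǒ-R    (L m)            = occurs (L m)
R1-analytic Ǒ-R    (R (⊔̌l m))       = occurs (R m)
R1-analytic exL    (L (⊓̂l m))       = occurs (L (⊓̂r m))
R1-analytic exL    (L (⊓̂r m))       = occurs (L (⊓̂l m))
R1-analytic exL    (R m)            = occurs (R m)
R1-analytic exR    (L m)            = occurs (L m)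
R1-analytic exR    (R (⊔̌l m))       = occurs (R (⊔̌r m))
R1-analytic exR    (R (⊔̌r m))       = occurs (R (⊔̌l m))
R1-analytic asL    (L (⊓̂l (⊓̂l m))) = occurs (L (⊓̂l m))
R1-analytic asL    (L (⊓̂l (⊓̂r m))) = occurs (L (⊓̂r (⊓̂l m)))
R1-analytic asL    (L (⊓̂r m))       = occurs (L (⊓̂r (⊓̂r m)))
R1-analytic asL    (R m)            = occurs (R m)
R1-analytic asL'   (L (⊓̂l m))       = occurs (L (⊓̂l (⊓̂l m)))
R1-analytic asL'   (L (⊓̂r (⊓̂l m))) = occurs (L (⊓̂l (⊓̂r m)))
R1-analytic asL'   (L (⊓̂r (⊓̂r m))) = occurs (L (⊓̂r m))
R1-analytic asL'   (R m)            = occurs (R m)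
R1-analytic asR    (L m)            = occurs (L m)
R1-analytic asR    (R (⊔̌l (⊔̌l m))) = occurs (R (⊔̌l m))
R1-analytic asR    (R (⊔̌l (⊔̌r m))) = occurs (R (⊔̌r (⊔̌l m)))
R1-analytic asR    (R (⊔̌r m))       = occurs (R (⊔̌r (⊔̌r m)))
R1-analytic asR'   (L m)            = occurs (L m)
R1-analytic asR'   (R (⊔̌l m))       = occurs (R (⊔̌l (⊔̌l m)))
R1-analytic asR'   (R (⊔̌r (⊔̌l m))) = occurs (R (⊔̌l (⊔̌r m)))
R1-analytic asR'   (R (⊔̌r (⊔̌r m))) = occurs (R (⊔̌r m))
R1-analytic wL     (L m)            = occurs (L (⊓̂l m))
R1-analytic wL     (R m)            = occurs (R m)
R1-analytic wR     (L m)            = occurs (L m)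
R1-analytic wR     (R m)            = occurs (R (⊔̌l m))
R1-analytic cL     (L (⊓̂l m))       = occurs (L m)
R1-analytic cL     (L (⊓̂r m))       = occurs (L m)
R1-analytic cL     (R m)            = occurs (R m)
R1-analytic cR     (L m)            = occurs (L m)
R1-analytic cR     (R (⊔̌l m))       = occurs (R m)
R1-analytic cR     (R (⊔̌r m))       = occurs (R m)
R1-analytic 1L     (R m)            = occurs (R m)
R1-analytic 0R     (L m)            = occurs (L m)
R1-analytic ⊓L     (L (⊓̂l here))    = immediate ⊓l (L here)
R1-analytic ⊓L     (L (⊓̂r here))    = immediate ⊓r (L here)
R1-analytic ⊓L     (R m)            = occurs (R m)
R1-analytic ⊔R     (L m)            = occurs (L m)
R1-analytic ⊔R     (R (⊔̌l here))    = immediate ⊔l (R here)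
R1-analytic ⊔R     (R (⊔̌r here))    = immediate ⊔r (R here)
R1-analytic N-mon  (L m)            = occurs (L (inN m))
R1-analytic N-mon  (R m)            = occurs (R (inN m))
R1-analytic N-mon' (L (inN m))      = occurs (L m)
R1-analytic N-mon' (R (inN m))      = occurs (R m)
R1-analytic P-mon  (L m)            = occurs (L (inP m))
R1-analytic P-mon  (R m)            = occurs (R (inP m))
R1-analytic P-mon' (L (inP m))      = occurs (L m)
R1-analytic P-mon' (R (inP m))      = occurs (R m)
R1-analytic PǑ     (R m)            = occurs (R m)
R1-analytic PÎ     (L m)            = occurs (L m)
R1-analytic nL     (L (inN here))   = immediate n◁ (L here)
R1-analytic nL     (R m)            = occurs (R m)
R1-analytic nR     (L m)            = occurs (L m)
R1-analytic nR     (R (inN here))   = immediate n◁ (R here)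
R1-analytic pL     (L (inP here))   = immediate p◁ (L here)
R1-analytic pL     (R m)            = occurs (R m)
R1-analytic pR     (L m)            = occurs (L m)
R1-analytic pR     (R (inP here))   = immediate p◁ (R here)
R1-analytic ∗L     (L (in∗ m))      = occurs (R m)
R1-analytic ∗L     (R m)            = occurs (L (in∗ m))
R1-analytic ∗R     (L m)            = occurs (R (in∗ m))
R1-analytic ∗R     (R (in∗ m))      = occurs (L m)
R1-analytic ∗C     (L m)            = occurs (R (in∗ m))
R1-analytic ∗C     (R m)            = occurs (L (in∗ m))
R1-analytic ∗C'    (L (in∗ m))      = occurs (R m)
R1-analytic ∗C'    (R (in∗ m))      = occurs (L m)
R1-analytic N∗L    (L (inN (in∗ m))) = occurs (L (in∗ (inN m)))
R1-analytic N∗L    (R m)            = occurs (R m)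
R1-analytic N∗R    (L m)            = occurs (L m)
R1-analytic N∗R    (R (inN (in∗ m))) = occurs (R (in∗ (inN m)))
R1-analytic ∼L     (L (in∗ here))   = immediate ∼◁ (L here)
R1-analytic ∼L     (R m)            = occurs (R m)
R1-analytic ∼R     (L m)            = occurs (L m)
R1-analytic ∼R     (R (in∗ here))   = immediate ∼◁ (R here)

R2-analyticˡ : ∀ {s₁ s₂} → R2 c s₁ s₂ t → s₁ ⊴ t
R2-analyticˡ ⊓R (L m)    = occurs (L (⊓̂l m))
R2-analyticˡ ⊓R (R here) = immediate ⊓l (R here)
R2-analyticˡ ⊔L (L here) = immediate ⊔l (L here)
R2-analyticˡ ⊔L (R m)    = occurs (R (⊔̌l m))

R2-analyticʳ : ∀ {s₁ s₂} → R2 c s₁ s₂ t → s₂ ⊴ t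
R2-analyticʳ ⊓R (L m)    = occurs (L (⊓̂r m))
R2-analyticʳ ⊓R (R here) = immediate ⊓r (R here)
R2-analyticʳ ⊔L (L here) = immediate ⊔r (L here)
R2-analyticʳ ⊔L (R m)    = occurs (R (⊔̌r m))

cut-free-analytic : {F : TFm c} (d : CutFree c s) → F ∈Der d → F ≼ s
cut-free-analytic d             (atRoot m)  = occurs m
cut-free-analytic (rule1 ρ d)   (above1 m)  = ≼-trans (cut-free-analytic d m) (R1-analytic ρ)
cut-free-analytic (rule2 ρ d e) (above2l m) = ≼-trans (cut-free-analytic d m) (R2-analyticˡ ρ)
cut-free-analytic (rule2 ρ d e) (above2r m) = ≼-trans (cut-free-analytic e m) (R2-analyticʳ ρ)
cut-free-analytic (cut () d e)  (aboveCl m)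
cut-free-analytic (cut () d e)  (aboveCr m)

mainTheorem8 : (c : Calc) → CutElimination c × SubformulaProperty c
mainTheorem8 c = (λ _ → eliminate-cuts) , (λ _ d _ → cut-free-analytic d)
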